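{- For every $n\ge 4$, the independence polynomial of the apple graph $A_n$ is real-rooted; hence its coefficient sequence is log-concave and unimodal.
   Context: The $n$-th apple graph $A_n$ is obtained from the path $1,2,\dots,n$ by adding the edge $\{2,n\}$. For a graph $H$, $I(H,x)=\sum_{k\ge0}i_k(H)x^k$, where $i_k(H)$ is the number of independent sets of size $k$. Real-rooted means all complex zeros are real. -}

module Defs where

open import Level using (0ℓ)
open import Data.Bool using (Bool; true; false; _∧_; _∨_; not; if_then_else_)
open import Data.Nat using (ℕ; zero; suc; _∸_; _≡ᵇ_)
import Data.Nat as N
open import Data.Bool.ListAction using (all)
open import Data.Fin using (Fin; toℕ)
open import Data.Fin.Subset using (Subset; inside; outside; ∣_∣)
open import Data.Vec using (Vec; []; _∷_; lookup)
open import Data.List using (List; []; _∷_; _++_; map; filter; length; upTo; allFin)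
open import Data.Product using (Σ; ∃; _×_; _,_)
import Data.Product
import Data.Sum
import Data.Bool
open import Relation.Nullary using (¬_)
open import Relation.Binary.PropositionalEquality using (_≡_)
open import Algebra.Bundles using (CommutativeRing)

-- The apple graph A_n.  Vertex v ∈ {1,…,n} is represented by i : Fin n
-- with toℕ i = v - 1.  Edges: the path edges {v, v+1} (i.e. {i, i+1}),
-- plus the edge {2, n} (i.e. {1, n-1}).

appleAdjℕ : ℕ → ℕ → ℕ → Bool
appleAdjℕ n i j =
  (suc i ≡ᵇ j) ∨ (suc j ≡ᵇ i)
  ∨ ((i ≡ᵇ 1) ∧ (j ≡ᵇ (n ∸ 1)))
  ∨ ((j ≡ᵇ 1) ∧ (i ≡ᵇ (n ∸ 1)))

appleAdj : (n : ℕ) → Fin n → Fin n → Bool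
appleAdj n i j = appleAdjℕ n (toℕ i) (toℕ j)

memB : ∀ {n} → Fin n → Subset n → Bool
memB i S with lookup S i
... | inside  = true
... | outside = false

isIndependent : (n : ℕ) → Subset n → Bool
isIndependent n S =
  all (λ i → all (λ j → not (memB i S ∧ memB j S ∧ appleAdj n i j)) (allFin n)) (allFin n)

allSubsets : (n : ℕ) → List (Subset n)
allSubsets zero    = [] ∷ []
allSubsets (suc n) = map (inside ∷_) (allSubsets n) ++ map (outside ∷_) (allSubsets n)

indCoeff : ℕ → ℕ → ℕ
indCoeff n k =
  length (filter (λ S → (isIndependent n S ∧ (∣ S ∣ ≡ᵇ k)) Data.Bool.≟ true) (allSubsets n))

-- I(A_n, x) as its list of coefficients i_0, …, i_n (ascending degree);
-- i_k = 0 for k > n.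
indPoly : ℕ → List ℕ
indPoly n = map (indCoeff n) (upTo (suc n))

-- The real numbers, axiomatised as a complete ordered field (unique up to
-- isomorphism).  The theorem quantifies over every such structure.

record CompleteOrderedField : Set₁ where
  field
    cring : CommutativeRing 0ℓ 0ℓ
  open CommutativeRing cring public
  field
    0≉1     : ¬ (0# ≈ 1#)
    inverse : ∀ x → ¬ (x ≈ 0#) → ∃ λ y → (x * y) ≈ 1#
    _≤ᴿ_    : Carrier → Carrier → Set
    ≤-resp  : ∀ {x x' y y'} → x ≈ x' → y ≈ y' → x ≤ᴿ y → x' ≤ᴿ y'
    ≤-refl  : ∀ {x} → x ≤ᴿ x
    ≤-trans : ∀ {x y z} → x ≤ᴿ y → y ≤ᴿ z → x ≤ᴿ z
    ≤-antisym : ∀ {x y} → x ≤ᴿ y → y ≤ᴿ x → x ≈ y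
    ≤-total : ∀ x y → (x ≤ᴿ y) Data.Sum.⊎ (y ≤ᴿ x)
    +-mono  : ∀ {x y} z → x ≤ᴿ y → (x + z) ≤ᴿ (y + z)
    *-nonneg : ∀ {x y} → 0# ≤ᴿ x → 0# ≤ᴿ y → 0# ≤ᴿ (x * y)
    complete : (P : Carrier → Set) → (∃ P) → (∃ λ b → ∀ x → P x → x ≤ᴿ b) →
               ∃ λ s → (∀ x → P x → x ≤ᴿ s) × (∀ b → (∀ x → P x → x ≤ᴿ b) → s ≤ᴿ b)

module _ (R : CompleteOrderedField) where
  open CompleteOrderedField R

  ℕ→R : ℕ → Carrier
  ℕ→R zero    = 0#
  ℕ→R (suc m) = 1# + ℕ→R m

  -- complex numbers over R as pairs (re , im)
  ℂ : Set
  ℂ = Carrier × Carrier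

  _+ℂ_ : ℂ → ℂ → ℂ
  (a , b) +ℂ (c , d) = (a + c) , (b + d)

  _*ℂ_ : ℂ → ℂ → ℂ
  (a , b) *ℂ (c , d) = ((a * c) - (b * d)) , ((a * d) + (b * c))

  evalℂ : List ℕ → ℂ → ℂ
  evalℂ []       z = 0# , 0#
  evalℂ (c ∷ cs) z = (ℕ→R c , 0#) +ℂ (z *ℂ evalℂ cs z)

  IsRootℂ : List ℕ → ℂ → Set
  IsRootℂ p z = let (u , v) = evalℂ p z in (u ≈ 0#) × (v ≈ 0#)

  RealRooted : List ℕ → Set
  RealRooted p = ∀ (z : ℂ) → IsRootℂ p z → Data.Product.proj₂ z ≈ 0#

LogConcave : (ℕ → ℕ) → Set
LogConcave a = ∀ k → a k N.* a (suc (suc k)) N.≤ a (suc k) N.* a (suc k)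

Unimodal : (ℕ → ℕ) → Set
Unimodal a = ∃ λ m → (∀ i j → i N.≤ j → j N.≤ m → a i N.≤ a j)
                   × (∀ i j → m N.≤ i → i N.≤ j → a j N.≤ a i)

module Submission where

-- Let p_m be the polynomials with p_0 = 2 + x, p_1 = 1 + x and
-- p_(m+2) = p_(m+1) + x p_m.  Deciding whether vertices 1 and 2 are used and
-- counting independent sets of paths gives I(A_(m+2)) = p_(m+1).
--
-- Real roots: at z = u + iv the "Wronskians" W_m = Im (p_(m+1)(z) · conj p_m(z))
-- satisfy W_0 = v and W_(m+2) = v |p_(m+1)(z)|² + |z|² W_m, so that
-- v W_m ≥ (v²)^(e+1) for some e.  At a zero of p_(m+1) we get W_m = 0, so v² is
-- nilpotent and v = 0.
--
-- Log-concavity and unimodality do not go through the roots: the coefficient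
-- sequences are PF₂ (a_i a_(j+1) ≤ a_(i+1) a_j for i < j), a property that the
-- recurrence preserves together with two mixed inequalities between
-- consecutive terms.

open import Data.Nat as ℕ using (ℕ; zero; suc)
import Data.Nat.Properties as ℕ
open import Data.Product using (_×_; _,_)
open import Data.List using (applyUpTo; upTo)
import Data.List.Properties as List
open import Function using (id; _∘_)
open import Relation.Binary.PropositionalEquality as ≡ using (_≡_)
open import Algebra.Bundles using (CommutativeRing)

open import Defs

module CoefficientSequences where

  open import Data.Nat using (_+_; _*_; _≤_; _<_; z≤n; s≤s; _<?_; >-nonZero)
  open import Data.Nat.Properties
  open import Data.Product using (∃; proj₁)
  open import Data.Sum using (inj₁; inj₂)
  open import Data.Empty using (⊥-elim)
  open import Relation.Nullary using (yes; no)
  open import Relation.Binary.PropositionalEquality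
    using (refl; sym; trans; cong; cong₂; subst; subst₂; module ≡-Reasoning)
  open import Algebra.Properties.CommutativeSemigroup +-commutativeSemigroup
    using () renaming (interchange to +-interchange)

  shift : (ℕ → ℕ) → ℕ → ℕ
  shift a zero    = 0
  shift a (suc k) = a k

  -- apple m is the coefficient sequence of I(A_(m+1)) for m ≥ 1; apple 0 = 2 + x
  -- is not an independence polynomial and only starts the recurrence.
  apple : ℕ → ℕ → ℕ
  apple zero          zero          = 2
  apple zero          (suc zero)    = 1
  apple zero          (suc (suc k)) = 0
  apple (suc zero)    zero          = 1
  apple (suc zero)    (suc zero)    = 1
  apple (suc zero)    (suc (suc k)) = 0
  apple (suc (suc m)) k             = apple (suc m) k + shift (apple m) k

  apple-vanishes : ∀ m k → suc (suc m) ≤ k → apple m k ≡ 0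
  apple-vanishes zero          (suc zero)    (s≤s ())
  apple-vanishes zero          (suc (suc k)) _ = refl
  apple-vanishes (suc zero)    (suc zero)    (s≤s ())
  apple-vanishes (suc zero)    (suc (suc k)) _ = refl
  apple-vanishes (suc (suc m)) (suc k) (s≤s m+3≤k) =
    cong₂ _+_ (apple-vanishes (suc m) (suc k) (m≤n⇒m≤1+n m+3≤k))
              (apple-vanishes m k (≤-trans (n≤1+n _) m+3≤k))

  apple-constant-positive : ∀ m → 1 ≤ apple m 0
  apple-constant-positive zero          = s≤s z≤n
  apple-constant-positive (suc zero)    = s≤s z≤n
  apple-constant-positive (suc (suc m)) = ≤-trans (apple-constant-positive (suc m)) (m≤m+n _ 0)

  Recurrent : (ℕ → ℕ → ℕ) → Set
  Recurrent F = ∀ m k → F (suc (suc m)) k ≡ F (suc m) k + shift (F m) k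

  shift-cong : ∀ {a b} → (∀ k → a k ≡ b k) → ∀ k → shift a k ≡ shift b k
  shift-cong a≗b zero    = refl
  shift-cong a≗b (suc k) = a≗b k

  recurrent-unique : ∀ {F G} → Recurrent F → Recurrent G →
    (∀ k → F 0 k ≡ G 0 k) → (∀ k → F 1 k ≡ G 1 k) → ∀ m k → F m k ≡ G m k
  recurrent-unique {F} {G} recF recG base₀ base₁ m = proj₁ (agree m)
    where
    agree : ∀ m → (∀ k → F m k ≡ G m k) × (∀ k → F (suc m) k ≡ G (suc m) k)
    agree zero    = base₀ , base₁
    agree (suc m) with agree m
    ... | F≗G , F′≗G′ = F′≗G′ , λ k →
      trans (recF m k) (trans (cong₂ _+_ (F′≗G′ k) (shift-cong F≗G k)) (sym (recG m k)))

  shift-+ : ∀ a b k → shift (λ k → a k + b k) k ≡ shift a k + shift b k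
  shift-+ a b zero    = refl
  shift-+ a b (suc k) = refl

  recurrent-+ : ∀ {F G} → Recurrent F → Recurrent G → Recurrent (λ m k → F m k + G m k)
  recurrent-+ {F} {G} recF recG m k = begin
    F (suc (suc m)) k + G (suc (suc m)) k
      ≡⟨ cong₂ _+_ (recF m k) (recG m k) ⟩
    (F (suc m) k + shift (F m) k) + (G (suc m) k + shift (G m) k)
      ≡⟨ +-interchange (F (suc m) k) (shift (F m) k) (G (suc m) k) (shift (G m) k) ⟩
    (F (suc m) k + G (suc m) k) + (shift (F m) k + shift (G m) k)
      ≡⟨ cong (F (suc m) k + G (suc m) k +_) (shift-+ (F m) (G m) k) ⟨
    (F (suc m) k + G (suc m) k) + shift (λ k → F m k + G m k) k ∎
    where open ≡-Reasoning

  recurrent-shift : ∀ {F} → Recurrent F → Recurrent (λ m → shift (F m))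
  recurrent-shift recF m zero    = refl
  recurrent-shift recF m (suc k) = recF m k

  apple-recurrent : Recurrent apple
  apple-recurrent m k = refl

  PF₂ : (ℕ → ℕ) → Set
  PF₂ a = ∀ i j → i < j → a i * a (suc j) ≤ a (suc i) * a j

  PF₂⇒logConcave : ∀ {a} → PF₂ a → LogConcave a
  PF₂⇒logConcave pf k = pf k (suc k) (n<1+n k)

  PF₂-cong : ∀ {a b} → (∀ k → a k ≡ b k) → PF₂ a → PF₂ b
  PF₂-cong a≗b pf i j i<j =
    subst₂ _≤_ (cong₂ _*_ (a≗b i) (a≗b (suc j))) (cong₂ _*_ (a≗b (suc i)) (a≗b j)) (pf i j i<j)

  distribˡ-mono : ∀ a c d a' c' d' → a * c ≤ a' * c' → a * d ≤ a' * d' →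
                  a * (c + d) ≤ a' * (c' + d')
  distribˡ-mono a c d a' c' d' p q = begin
    a * (c + d)       ≡⟨ *-distribˡ-+ a c d ⟩
    a * c + a * d     ≤⟨ +-mono-≤ p q ⟩
    a' * c' + a' * d' ≡⟨ *-distribˡ-+ a' c' d' ⟨
    a' * (c' + d')    ∎
    where open ≤-Reasoning

  distribʳ-mono : ∀ a b c a' b' c' → a * c ≤ a' * c' → b * c ≤ b' * c' →
                  (a + b) * c ≤ (a' + b') * c'
  distribʳ-mono a b c a' b' c' p q = begin
    (a + b) * c       ≡⟨ *-distribʳ-+ c a b ⟩
    a * c + b * c     ≤⟨ +-mono-≤ p q ⟩
    a' * c' + b' * c' ≡⟨ *-distribʳ-+ c' a' b' ⟨
    (a' + b') * c'    ∎
    where open ≤-Reasoning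

  -- The mixed inequalities are exactly what is needed to push PF₂ through
  -- the step (g , h) ↦ (h , h + x g).
  record Compatible (g h : ℕ → ℕ) : Set where
    field
      pf₂ˡ   : PF₂ g
      pf₂ʳ   : PF₂ h
      cross₁ : ∀ i j → i ≤ j → h i * g (suc j) ≤ h (suc i) * g j
      cross₂ : ∀ i j → i ≤ j → g i * h (suc (suc j)) ≤ g (suc i) * h (suc j)

  compatible-step : ∀ {g h} → Compatible g h → Compatible h (λ k → h k + shift g k)
  compatible-step {g} {h} c = record
    { pf₂ˡ   = pf₂ʳ
    ; pf₂ʳ   = λ { i (suc j) i<j+1 →
        distribʳ-mono (h i) (shift g i) (h′ (suc (suc j))) (h (suc i)) (g i) (h′ (suc j))
          (distribˡ-mono (h i) (h (suc (suc j))) (g (suc j)) (h (suc i)) (h (suc j)) (g j)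
             (pf₂ʳ i (suc j) i<j+1) (cross₁ i j (≤-pred i<j+1)))
          (distribˡ-mono (shift g i) (h (suc (suc j))) (g (suc j)) (g i) (h (suc j)) (g j)
             (shift-cross₂ i (suc j) (<⇒≤ i<j+1)) (shift-pf₂ i j i<j+1)) }
    ; cross₁ = λ i j i≤j →
        distribʳ-mono (h i) (shift g i) (h (suc j)) (h (suc i)) (g i) (h j)
          (pf₂ʳ-≤ i j i≤j) (shift-cross₂ i j i≤j)
    ; cross₂ = λ i j i≤j →
        distribˡ-mono (h i) (h (suc (suc j))) (g (suc j)) (h (suc i)) (h (suc j)) (g j)
          (pf₂ʳ i (suc j) (s≤s i≤j)) (cross₁ i j i≤j)
    }
    where
    open Compatible c
    h′ : ℕ → ℕ
    h′ k = h k + shift g k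
    shift-cross₂ : ∀ i j → i ≤ j → shift g i * h (suc j) ≤ g i * h j
    shift-cross₂ zero    j       _         = z≤n
    shift-cross₂ (suc i) (suc j) (s≤s i≤j) = cross₂ i j i≤j
    shift-pf₂ : ∀ i j → i < suc j → shift g i * g (suc j) ≤ g i * g j
    shift-pf₂ zero    j _           = z≤n
    shift-pf₂ (suc i) j (s≤s i<j)   = pf₂ˡ i j i<j
    pf₂ʳ-≤ : ∀ i j → i ≤ j → h i * h (suc j) ≤ h (suc i) * h j
    pf₂ʳ-≤ i j i≤j with m≤n⇒m<n∨m≡n i≤j
    ... | inj₁ i<j  = pf₂ʳ i j i<j
    ... | inj₂ refl = ≤-reflexive (*-comm (h i) (h (suc i)))

  apple-compatible : ∀ m → Compatible (apple m) (apple (suc m))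
  apple-compatible zero = record
    { pf₂ˡ   = λ { i (suc j) _ → x*0≤ (apple 0 i) }
    ; pf₂ʳ   = λ { i (suc j) _ → x*0≤ (apple 1 i) }
    ; cross₁ = λ { zero zero _ → s≤s z≤n
                 ; i (suc j) _ → x*0≤ (apple 1 i) }
    ; cross₂ = λ i j _ → x*0≤ (apple 0 i)
    }
    where
    x*0≤ : ∀ x {y} → x * 0 ≤ y
    x*0≤ x {y} = subst (_≤ y) (sym (*-zeroʳ x)) z≤n
  apple-compatible (suc m) = compatible-step (apple-compatible m)

  apple-PF₂ : ∀ m → PF₂ (apple m)
  apple-PF₂ m = Compatible.pf₂ˡ (apple-compatible m)

  -- A PF₂ sequence with a₀ > 0 that eventually vanishes rises to its first
  -- descent and falls from there on.
  module _ {a : ℕ → ℕ} (pf : PF₂ a) where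

    RisingUpTo : ℕ → Set
    RisingUpTo m = ∀ i → i < m → a i ≤ a (suc i)

    rising⇒monotone : ∀ {m} → RisingUpTo m → ∀ i j → i ≤ j → j ≤ m → a i ≤ a j
    rising⇒monotone r i j i≤j j≤m with m≤n⇒m<n∨m≡n i≤j
    ... | inj₂ refl = ≤-refl
    rising⇒monotone r i (suc j) _ j+1≤m | inj₁ (s≤s i≤j) =
      ≤-trans (rising⇒monotone r i j i≤j (<⇒≤ j+1≤m)) (r j j+1≤m)

    falling-after-descent : ∀ {m} → a (suc m) < a m → ∀ k → m ≤ k → a (suc k) ≤ a k
    falling-after-descent {m} d k m≤k with m≤n⇒m<n∨m≡n m≤k
    ... | inj₂ refl = <⇒≤ d
    ... | inj₁ m<k  = *-cancelˡ-≤ (a m) {{>-nonZero (≤-trans (s≤s z≤n) d)}} (begin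
      a m * a (suc k)   ≤⟨ pf m k m<k ⟩
      a (suc m) * a k   ≤⟨ *-monoˡ-≤ (a k) (<⇒≤ d) ⟩
      a m * a k         ∎)
      where open ≤-Reasoning

    first-descent : 1 ≤ a 0 → ∀ fuel k → a (fuel + k) ≡ 0 → RisingUpTo k →
                    ∃ λ m → RisingUpTo m × a (suc m) < a m
    first-descent a₀>0 fuel k vanish r with a (suc k) <? a k
    ... | yes d = k , r , d
    first-descent a₀>0 zero k vanish r | no _ =
      ⊥-elim (<⇒≱ a₀>0 (subst (a 0 ≤_) vanish (rising⇒monotone r 0 k z≤n ≤-refl)))
    first-descent a₀>0 (suc fuel) k vanish r | no ¬d =
      first-descent a₀>0 fuel (suc k) (subst (λ i → a i ≡ 0) (sym (+-suc fuel k)) vanish) r'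
      where
      r' : RisingUpTo (suc k)
      r' i (s≤s i≤k) with m≤n⇒m<n∨m≡n i≤k
      ... | inj₁ i<k  = r i i<k
      ... | inj₂ refl = ≮⇒≥ ¬d

    PF₂⇒unimodal : 1 ≤ a 0 → ∀ B → a B ≡ 0 → Unimodal a
    PF₂⇒unimodal a₀>0 B vanish
      with first-descent a₀>0 B 0 (subst (λ i → a i ≡ 0) (sym (+-identityʳ B)) vanish) (λ _ ())
    ... | m , r , d = m , rising⇒monotone r , falling
      where
      falling : ∀ i j → m ≤ i → i ≤ j → a j ≤ a i
      falling i j m≤i i≤j with m≤n⇒m<n∨m≡n i≤j
      ... | inj₂ refl = ≤-refl
      falling i (suc j) m≤i _ | inj₁ (s≤s i≤j) =
        ≤-trans (falling-after-descent d j (≤-trans m≤i i≤j)) (falling i j m≤i i≤j)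

open CoefficientSequences

module AppleIndependence where

  open import Data.Bool using (Bool; true; false; _∧_; not; T)
  open import Data.Bool.Properties using (T-∧; T-∨; T-≡; ⇔→≡)
  open import Data.Nat using (_≡ᵇ_; _∸_; _<_; z≤n; s≤s)
  open import Data.Nat.Properties using (≡ᵇ⇒≡; ≡⇒≡ᵇ)
  open import Data.Fin as Fin using (Fin; toℕ; fromℕ<)
  open import Data.Fin.Properties using (toℕ-fromℕ<)
  open import Data.Fin.Subset using (Subset)
  open import Data.Vec using (Vec; []; _∷_; lookup)
  open import Data.List using (allFin)
  open import Data.List.Relation.Unary.All.Properties using (all⁺; all⁻; tabulate⁺; tabulate⁻)
  open import Data.Product using (proj₁; proj₂)
  open import Data.Sum using (_⊎_; inj₁; inj₂)
  open import Data.Empty using (⊥)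
  open import Function using (_∘_; _⇔_; mk⇔; Equivalence)
  open import Relation.Nullary using (¬_)
  open import Relation.Binary.PropositionalEquality using (refl; sym; trans; cong; cong₂; subst; subst₂)
  open Equivalence

  noAdjacent : ∀ {m} → Vec Bool m → Bool
  noAdjacent []           = true
  noAdjacent (x ∷ [])     = true
  noAdjacent (x ∷ y ∷ xs) = not (x ∧ y) ∧ noAdjacent (y ∷ xs)

  lastOf : ∀ {m} → Vec Bool (suc m) → Bool
  lastOf (x ∷ [])     = x
  lastOf (x ∷ y ∷ xs) = lastOf (y ∷ xs)

  -- The path edges, and the edge {2, n} between s₁ and the last vertex.
  isAppleIndependent : ∀ {m} → Subset (suc (suc m)) → Bool
  isAppleIndependent (s₀ ∷ s₁ ∷ rest) = noAdjacent (s₀ ∷ s₁ ∷ rest) ∧ not (s₁ ∧ lastOf (s₁ ∷ rest))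

  at : ∀ {n} → Vec Bool n → ℕ → Bool
  at []       i       = false
  at (x ∷ xs) zero    = x
  at (x ∷ xs) (suc i) = at xs i

  memB≡at : ∀ {n} (i : Fin n) S → memB i S ≡ at S (toℕ i)
  memB≡at i S = trans (memB≡lookup i S) (lookup≡at i S)
    where
    memB≡lookup : ∀ {n} (i : Fin n) S → memB i S ≡ lookup S i
    memB≡lookup i S with lookup S i
    ... | true  = refl
    ... | false = refl
    lookup≡at : ∀ {n} (i : Fin n) (S : Vec Bool n) → lookup S i ≡ at S (toℕ i)
    lookup≡at Fin.zero    (x ∷ S) = refl
    lookup≡at (Fin.suc i) (x ∷ S) = lookup≡at i S

  at-bound : ∀ {n} (S : Vec Bool n) i → T (at S i) → i < n
  at-bound (x ∷ S) zero    _ = s≤s z≤n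
  at-bound (x ∷ S) (suc i) t = s≤s (at-bound S i t)

  lastOf≡at : ∀ {m} (S : Vec Bool (suc m)) → lastOf S ≡ at S m
  lastOf≡at (x ∷ [])     = refl
  lastOf≡at (x ∷ y ∷ xs) = lastOf≡at (y ∷ xs)

  T-not : ∀ {b} → T (not b) ⇔ (¬ T b)
  T-not {true}  = mk⇔ (λ ()) (λ ¬t → ¬t _)
  T-not {false} = mk⇔ (λ _ ()) (λ _ → _)

  noAdjacent⁻ : ∀ {m} (S : Vec Bool m) → T (noAdjacent S) → ∀ i → T (at S i) → ¬ T (at S (suc i))
  noAdjacent⁻ (x ∷ [])     _ zero    _ ()
  noAdjacent⁻ (x ∷ [])     _ (suc i) ()
  noAdjacent⁻ (x ∷ y ∷ xs) t zero    tx ty = T-not .to (proj₁ (T-∧ .to t)) (T-∧ .from (tx , ty))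
  noAdjacent⁻ (x ∷ y ∷ xs) t (suc i)       = noAdjacent⁻ (y ∷ xs) (proj₂ (T-∧ .to t)) i

  noAdjacent⁺ : ∀ {m} (S : Vec Bool m) → (∀ i → T (at S i) → ¬ T (at S (suc i))) → T (noAdjacent S)
  noAdjacent⁺ []           _ = _
  noAdjacent⁺ (x ∷ [])     _ = _
  noAdjacent⁺ (x ∷ y ∷ xs) h =
    T-∧ .from ( T-not .from (λ txy → h 0 (proj₁ (T-∧ .to txy)) (proj₂ (T-∧ .to txy)))
              , noAdjacent⁺ (y ∷ xs) (h ∘ suc))

  ≡ᵇ-pair : ∀ a b c d → T ((a ≡ᵇ b) ∧ (c ≡ᵇ d)) → a ≡ b × c ≡ d
  ≡ᵇ-pair a b c d t =
    ≡ᵇ⇒≡ a b (proj₁ (T-∧ {a ≡ᵇ b} .to t)) , ≡ᵇ⇒≡ c d (proj₂ (T-∧ {a ≡ᵇ b} .to t))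

  module _ (n : ℕ) where

    appleAdj-path : ∀ i → T (appleAdjℕ n i (suc i))
    appleAdj-path i = T-∨ {suc i ≡ᵇ suc i} .from (inj₁ (≡⇒≡ᵇ (suc i) (suc i) refl))

    appleAdj-closing : T (appleAdjℕ n 1 (n ∸ 1))
    appleAdj-closing =
      T-∨ {2 ≡ᵇ n ∸ 1} .from (inj₂ (T-∨ {n ∸ 1 ≡ᵇ 0} .from (inj₂
        (T-∨ {n ∸ 1 ≡ᵇ n ∸ 1} .from (inj₁ (≡⇒≡ᵇ (n ∸ 1) (n ∸ 1) refl))))))

    appleAdj-cases : ∀ i j → T (appleAdjℕ n i j) →
      (suc i ≡ j) ⊎ (suc j ≡ i) ⊎ (i ≡ 1 × j ≡ n ∸ 1) ⊎ (j ≡ 1 × i ≡ n ∸ 1)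
    appleAdj-cases i j t with T-∨ {suc i ≡ᵇ j} .to t
    ... | inj₁ e = inj₁ (≡ᵇ⇒≡ (suc i) j e)
    ... | inj₂ t′ with T-∨ {suc j ≡ᵇ i} .to t′
    ...   | inj₁ e = inj₂ (inj₁ (≡ᵇ⇒≡ (suc j) i e))
    ...   | inj₂ t″ with T-∨ {(i ≡ᵇ 1) ∧ (j ≡ᵇ n ∸ 1)} .to t″
    ...     | inj₁ e = inj₂ (inj₂ (inj₁ (≡ᵇ-pair i 1 j (n ∸ 1) e)))
    ...     | inj₂ e = inj₂ (inj₂ (inj₂ (≡ᵇ-pair j 1 i (n ∸ 1) e)))

  clash : ∀ {n} → Vec Bool n → ℕ → ℕ → Bool
  clash {n} S i j = at S i ∧ at S j ∧ appleAdjℕ n i j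

  NoClash : ∀ {n} → Vec Bool n → Set
  NoClash S = ∀ i j → ¬ T (clash S i j)

  module _ {n : ℕ} (S : Subset n) where

    memB-clash : ∀ i j → (memB i S ∧ memB j S ∧ appleAdj n i j) ≡ clash S (toℕ i) (toℕ j)
    memB-clash i j = cong₂ _∧_ (memB≡at i S) (cong (_∧ appleAdj n i j) (memB≡at j S))

    isIndependent⁻ : T (isIndependent n S) → NoClash S
    isIndependent⁻ t i j c = T-not .to free (subst T (sym (memB-clash i′ j′)) c′)
      where
      i<n : i < n
      i<n = at-bound S i (proj₁ (T-∧ .to c))
      j<n : j < n
      j<n = at-bound S j (proj₁ (T-∧ .to (proj₂ (T-∧ {at S i} .to c))))
      i′ j′ : Fin n
      i′ = fromℕ< i<n
      j′ = fromℕ< j<n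
      c′ : T (clash S (toℕ i′) (toℕ j′))
      c′ = subst₂ (λ a b → T (clash S a b)) (sym (toℕ-fromℕ< i<n)) (sym (toℕ-fromℕ< j<n)) c
      free : T (not (memB i′ S ∧ memB j′ S ∧ appleAdj n i′ j′))
      free = tabulate⁻ (all⁺ _ (allFin n) (tabulate⁻ (all⁺ _ (allFin n) t) i′)) j′

    isIndependent⁺ : NoClash S → T (isIndependent n S)
    isIndependent⁺ ind = all⁻ _ (tabulate⁺ λ i → all⁻ _ (tabulate⁺ λ j →
      T-not .from (λ c → ind (toℕ i) (toℕ j) (subst T (memB-clash i j) c))))

  module _ {m : ℕ} where

    noClash⇒apple : (S : Subset (suc (suc m))) → NoClash S → T (isAppleIndependent S)
    noClash⇒apple S@(s₀ ∷ s₁ ∷ rest) ind = T-∧ .from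
      ( noAdjacent⁺ S (λ i tᵢ tᵢ₊₁ →
          ind i (suc i) (T-∧ .from (tᵢ , T-∧ .from (tᵢ₊₁ , appleAdj-path (suc (suc m)) i))))
      , T-not .from (λ t → ind 1 (suc m) (T-∧ .from
          ( proj₁ (T-∧ {s₁} .to t)
          , T-∧ .from ( subst T (lastOf≡at (s₁ ∷ rest)) (proj₂ (T-∧ {s₁} .to t))
                      , appleAdj-closing (suc (suc m)))))))

    apple⇒noClash : (S : Subset (suc (suc m))) → T (isAppleIndependent S) → NoClash S
    apple⇒noClash S@(s₀ ∷ s₁ ∷ rest) t i j c = excluded (appleAdj-cases (suc (suc m)) i j adj)
      where
      tᵢ : T (at S i)
      tᵢ = proj₁ (T-∧ .to c)
      tⱼ : T (at S j)
      tⱼ = proj₁ (T-∧ {at S j} .to (proj₂ (T-∧ {at S i} .to c)))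
      adj : T (appleAdjℕ (suc (suc m)) i j)
      adj = proj₂ (T-∧ {at S j} .to (proj₂ (T-∧ {at S i} .to c)))
      path : ∀ i → T (at S i) → ¬ T (at S (suc i))
      path = noAdjacent⁻ S (proj₁ (T-∧ .to t))
      closing : T s₁ → ¬ T (at S (suc m))
      closing t₁ tₗ = T-not .to (proj₂ (T-∧ {noAdjacent S} .to t))
                       (T-∧ .from (t₁ , subst T (sym (lastOf≡at (s₁ ∷ rest))) tₗ))
      excluded : (suc i ≡ j) ⊎ (suc j ≡ i) ⊎ (i ≡ 1 × j ≡ suc m) ⊎ (j ≡ 1 × i ≡ suc m) → ⊥
      excluded (inj₁ e)                  = path i tᵢ (subst (T ∘ at S) (sym e) tⱼ)
      excluded (inj₂ (inj₁ e))           = path j tⱼ (subst (T ∘ at S) (sym e) tᵢ)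
      excluded (inj₂ (inj₂ (inj₁ (e₁ , eₗ)))) =
        closing (subst (T ∘ at S) e₁ tᵢ) (subst (T ∘ at S) eₗ tⱼ)
      excluded (inj₂ (inj₂ (inj₂ (e₁ , eₗ)))) =
        closing (subst (T ∘ at S) e₁ tⱼ) (subst (T ∘ at S) eₗ tᵢ)

  isIndependent≡isAppleIndependent : ∀ {m} (S : Subset (suc (suc m))) →
                                     isIndependent (suc (suc m)) S ≡ isAppleIndependent S
  isIndependent≡isAppleIndependent S = ⇔→≡ (mk⇔
    (λ e → T-≡ .to (noClash⇒apple S (isIndependent⁻ S (T-≡ .from e))))
    (λ e → T-≡ .to (isIndependent⁺ S (apple⇒noClash S (T-≡ .from e)))))

open AppleIndependence

module Counting where

  open import Data.Bool using (Bool; true; false; _∧_; not; if_then_else_)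
  import Data.Bool as Bool
  open import Data.Bool.Properties using (∧-zeroʳ)
  open import Data.Nat using (_+_; _≡ᵇ_)
  open import Data.Nat.Properties using (+-comm)
  open import Data.Fin.Subset using (Subset; ∣_∣)
  open import Data.Vec using (Vec; []; _∷_)
  open import Data.List using (List; []; _∷_; _++_; map; filter; length)
  open import Data.List.Properties using (filter-++; length-++)
  open import Function using (_∘_)
  open import Relation.Binary.PropositionalEquality
    using (refl; trans; cong; cong₂; module ≡-Reasoning)

  -- Phrased exactly as in indCoeff, which is therefore a countᵇ by definition.
  countᵇ : ∀ {A : Set} → (A → Bool) → List A → ℕ
  countᵇ p xs = length (filter (λ x → p x Bool.≟ true) xs)

  module _ {A : Set} where

    countᵇ-++ : ∀ (p : A → Bool) xs ys → countᵇ p (xs ++ ys) ≡ countᵇ p xs + countᵇ p ys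
    countᵇ-++ p xs ys = trans (cong length (filter-++ _ xs ys)) (length-++ (filter _ xs))

    countᵇ-map : ∀ {B : Set} (p : A → Bool) (f : B → A) xs → countᵇ p (map f xs) ≡ countᵇ (p ∘ f) xs
    countᵇ-map p f []       = refl
    countᵇ-map p f (x ∷ xs) with p (f x)
    ... | true  = cong suc (countᵇ-map p f xs)
    ... | false = countᵇ-map p f xs

    countᵇ-cong : ∀ {p q : A → Bool} → (∀ x → p x ≡ q x) → ∀ xs → countᵇ p xs ≡ countᵇ q xs
    countᵇ-cong p≗q []       = refl
    countᵇ-cong {p} {q} p≗q (x ∷ xs) with p x | q x | p≗q x
    ... | true  | true  | refl = cong suc (countᵇ-cong p≗q xs)
    ... | false | false | refl = countᵇ-cong p≗q xs

    countᵇ-none : ∀ {p : A → Bool} → (∀ x → p x ≡ false) → ∀ xs → countᵇ p xs ≡ 0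
    countᵇ-none none xs = trans (countᵇ-cong none xs) (countᵇ-false xs)
      where
      countᵇ-false : ∀ xs → countᵇ (λ _ → false) xs ≡ 0
      countᵇ-false []       = refl
      countᵇ-false (_ ∷ xs) = countᵇ-false xs

    countᵇ-singleton : ∀ (p : A → Bool) x → countᵇ p (x ∷ []) ≡ (if p x then 1 else 0)
    countᵇ-singleton p x with p x
    ... | true  = refl
    ... | false = refl

  countᵇ-subsets-suc : ∀ n (p : Subset (suc n) → Bool) →
    countᵇ p (allSubsets (suc n))
      ≡ countᵇ (p ∘ (true ∷_)) (allSubsets n) + countᵇ (p ∘ (false ∷_)) (allSubsets n)
  countᵇ-subsets-suc n p =
    trans (countᵇ-++ p (map (true ∷_) (allSubsets n)) _)
          (cong₂ _+_ (countᵇ-map p _ (allSubsets n)) (countᵇ-map p _ (allSubsets n)))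

  -- T is an independent k-set of a path whose preceding vertex is used iff p;
  -- when e holds, the final vertex of p ∷ T must be unused.
  isPathSet : ∀ {m} → Bool → Bool → ℕ → Vec Bool m → Bool
  isPathSet p e k T = (noAdjacent (p ∷ T) ∧ not (e ∧ lastOf (p ∷ T))) ∧ (∣ T ∣ ≡ᵇ k)

  paths : ℕ → Bool → Bool → ℕ → ℕ
  paths zero    p     e k = if not (e ∧ p) ∧ (0 ≡ᵇ k) then 1 else 0
  paths (suc m) true  e k = paths m false e k
  paths (suc m) false e k = shift (paths m true e) k + paths m false e k

  count-paths : ∀ m p e k → countᵇ (isPathSet p e k) (allSubsets m) ≡ paths m p e k
  count-paths zero    p e k = countᵇ-singleton (isPathSet p e k) []
  count-paths (suc m) true e k =
    trans (countᵇ-subsets-suc m (isPathSet true e k))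
          (cong₂ _+_ (countᵇ-none (λ _ → refl) (allSubsets m)) (count-paths m false e k))
  count-paths (suc m) false e k =
    trans (countᵇ-subsets-suc m (isPathSet false e k)) (cong₂ _+_ (chosen k) (count-paths m false e k))
    where
    chosen : ∀ k → countᵇ (isPathSet false e k ∘ (true ∷_)) (allSubsets m) ≡ shift (paths m true e) k
    chosen zero    = countᵇ-none (λ _ → ∧-zeroʳ _) (allSubsets m)
    chosen (suc k) = count-paths m true e k

  -- Split on the first two vertices: both in the set is impossible, and
  -- otherwise what remains is a path problem on the last m vertices.
  appleCount : ℕ → ℕ → ℕ
  appleCount m k = shift (paths m false false) k + (shift (paths m true true) k + paths m false false k)

  count-apple : ∀ m k →
    countᵇ (λ S → isAppleIndependent S ∧ (∣ S ∣ ≡ᵇ k)) (allSubsets (suc (suc m))) ≡ appleCount m k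
  count-apple m k =
    trans (countᵇ-subsets-suc (suc m) _)
          (cong₂ _+_ (trans (countᵇ-subsets-suc m _)
                            (cong₂ _+_ (countᵇ-none (λ _ → refl) (allSubsets m)) (only₀ k)))
                     (trans (countᵇ-subsets-suc m _) (cong₂ _+_ (only₁ k) (count-paths m false false k))))
    where
    only₀ : ∀ k → countᵇ (λ T → isAppleIndependent (true ∷ false ∷ T) ∧ (suc ∣ T ∣ ≡ᵇ k))
                         (allSubsets m)
                   ≡ shift (paths m false false) k
    only₀ zero    = countᵇ-none (λ _ → ∧-zeroʳ _) (allSubsets m)
    only₀ (suc k) = count-paths m false false k
    only₁ : ∀ k → countᵇ (λ T → isAppleIndependent (false ∷ true ∷ T) ∧ (suc ∣ T ∣ ≡ᵇ k))
                         (allSubsets m)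
                  ≡ shift (paths m true true) k
    only₁ zero    = countᵇ-none (λ _ → ∧-zeroʳ _) (allSubsets m)
    only₁ (suc k) = count-paths m true true k

  paths-recurrent : ∀ p e → Recurrent (λ m → paths m p e)
  paths-recurrent true  e m k = +-comm (shift (paths m true e) k) (paths m false e k)
  paths-recurrent false e m k =
    +-comm (shift (paths m false e) k) (shift (paths m true e) k + paths m false e k)

  appleCount-recurrent : Recurrent appleCount
  appleCount-recurrent =
    recurrent-+ (recurrent-shift (paths-recurrent false false))
                (recurrent-+ (recurrent-shift (paths-recurrent true true)) (paths-recurrent false false))

  appleCount≡apple : ∀ m k → appleCount m k ≡ apple (suc m) k
  appleCount≡apple = recurrent-unique appleCount-recurrent (apple-recurrent ∘ suc) base₀ base₁
    where
    base₀ : ∀ k → appleCount 0 k ≡ apple 1 k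
    base₀ 0 = refl
    base₀ 1 = refl
    base₀ (suc (suc k)) = refl
    base₁ : ∀ k → appleCount 1 k ≡ apple 2 k
    base₁ 0 = refl
    base₁ 1 = refl
    base₁ 2 = refl
    base₁ (suc (suc (suc k))) = refl

  indCoeff≡apple : ∀ m k → indCoeff (suc (suc m)) k ≡ apple (suc m) k
  indCoeff≡apple m k = begin
    indCoeff (suc (suc m)) k
      ≡⟨ countᵇ-cong (λ S → cong (_∧ (∣ S ∣ ≡ᵇ k)) (isIndependent≡isAppleIndependent S))
                     (allSubsets (suc (suc m))) ⟩
    countᵇ (λ S → isAppleIndependent S ∧ (∣ S ∣ ≡ᵇ k)) (allSubsets (suc (suc m)))
      ≡⟨ count-apple m k ⟩
    appleCount m k
      ≡⟨ appleCount≡apple m k ⟩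
    apple (suc m) k ∎
    where open ≡-Reasoning

open Counting

module ℤ-RingSolver {c ℓ} (CR : CommutativeRing c ℓ) where

  open import Data.Nat.Properties using (+-suc)
  open import Data.Integer as ℤ using (ℤ; +_; -[1+_]; _⊖_; _◃_; sign; ∣_∣)
  import Data.Integer.Properties as ℤ
  open import Data.Sign as Sign using (Sign)
  open import Data.Maybe as Maybe using (Maybe)
  open import Relation.Nullary.Decidable using (dec⇒maybe)
  import Algebra.Solver.Ring.AlmostCommutativeRing as ACR
  import Algebra.Solver.Ring as RingSolver

  open CommutativeRing CR
  open import Algebra.Properties.Ring ring using (-‿involutive; -0#≈0#; -‿distribˡ-*; -‿distribʳ-*)
  open import Algebra.Properties.AbelianGroup +-abelianGroup using (⁻¹-∙-comm)
  open import Algebra.Properties.CommutativeSemigroup +-commutativeSemigroup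
    using () renaming (interchange to +-interchange)
  open import Algebra.Properties.Semiring.Mult semiring
    using (×-homo-+; ×1-homo-*) renaming (_×_ to _×ₙ_)
  open import Relation.Binary.Reasoning.Setoid setoid

  fromℕ : ℕ → Carrier
  fromℕ n = n ×ₙ 1#

  fromℤ : ℤ → Carrier
  fromℤ (+ n)    = fromℕ n
  fromℤ -[1+ n ] = - fromℕ (suc n)

  fromℤ-⊖ : ∀ m n → fromℤ (m ⊖ n) ≈ fromℕ m - fromℕ n
  fromℤ-⊖ zero    zero    = sym (-‿inverseʳ 0#)
  fromℤ-⊖ zero    (suc n) = sym (+-identityˡ _)
  fromℤ-⊖ (suc m) zero    = sym (trans (+-congˡ -0#≈0#) (+-identityʳ _))
  fromℤ-⊖ (suc m) (suc n) = begin
    fromℤ (suc m ⊖ suc n)             ≡⟨ ≡.cong fromℤ (ℤ.[1+m]⊖[1+n]≡m⊖n m n) ⟩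
    fromℤ (m ⊖ n)                     ≈⟨ fromℤ-⊖ m n ⟩
    fromℕ m - fromℕ n                 ≈⟨ +-identityˡ _ ⟨
    0# + (fromℕ m - fromℕ n)          ≈⟨ +-congʳ (-‿inverseʳ 1#) ⟨
    (1# - 1#) + (fromℕ m - fromℕ n)   ≈⟨ +-interchange 1# (- 1#) (fromℕ m) (- fromℕ n) ⟩
    (1# + fromℕ m) + (- 1# + - fromℕ n) ≈⟨ +-congˡ (⁻¹-∙-comm 1# (fromℕ n)) ⟩
    fromℕ (suc m) - fromℕ (suc n)     ∎

  signed : Sign → Carrier → Carrier
  signed Sign.+ x = x
  signed Sign.- x = - x

  signed-cong : ∀ s {x y} → x ≈ y → signed s x ≈ signed s y
  signed-cong Sign.+ x≈y = x≈y
  signed-cong Sign.- x≈y = -‿cong x≈y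

  signed-* : ∀ s t x y → signed (s Sign.* t) (x * y) ≈ signed s x * signed t y
  signed-* Sign.+ Sign.+ x y = refl
  signed-* Sign.+ Sign.- x y = -‿distribʳ-* x y
  signed-* Sign.- Sign.+ x y = -‿distribˡ-* x y
  signed-* Sign.- Sign.- x y = begin
    x * y        ≈⟨ -‿involutive (x * y) ⟨
    - - (x * y)  ≈⟨ -‿cong (-‿distribˡ-* x y) ⟩
    - (- x * y)  ≈⟨ -‿distribʳ-* (- x) y ⟩
    - x * - y    ∎

  fromℤ-◃ : ∀ s n → fromℤ (s ◃ n) ≈ signed s (fromℕ n)
  fromℤ-◃ Sign.+ zero    = refl
  fromℤ-◃ Sign.- zero    = sym -0#≈0#
  fromℤ-◃ Sign.+ (suc n) = refl
  fromℤ-◃ Sign.- (suc n) = refl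

  fromℤ-signed : ∀ i → fromℤ i ≈ signed (sign i) (fromℕ ∣ i ∣)
  fromℤ-signed (+ n)    = refl
  fromℤ-signed -[1+ n ] = refl

  fromℤ-* : ∀ i j → fromℤ (i ℤ.* j) ≈ fromℤ i * fromℤ j
  fromℤ-* i j = begin
    fromℤ (sign i Sign.* sign j ◃ ∣ i ∣ ℕ.* ∣ j ∣)
      ≈⟨ fromℤ-◃ (sign i Sign.* sign j) (∣ i ∣ ℕ.* ∣ j ∣) ⟩
    signed (sign i Sign.* sign j) (fromℕ (∣ i ∣ ℕ.* ∣ j ∣))
      ≈⟨ signed-cong (sign i Sign.* sign j) (×1-homo-* ∣ i ∣ ∣ j ∣) ⟩
    signed (sign i Sign.* sign j) (fromℕ ∣ i ∣ * fromℕ ∣ j ∣)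
      ≈⟨ signed-* (sign i) (sign j) (fromℕ ∣ i ∣) (fromℕ ∣ j ∣) ⟩
    signed (sign i) (fromℕ ∣ i ∣) * signed (sign j) (fromℕ ∣ j ∣)
      ≈⟨ *-cong (fromℤ-signed i) (fromℤ-signed j) ⟨
    fromℤ i * fromℤ j                                  ∎

  fromℤ-+ : ∀ i j → fromℤ (i ℤ.+ j) ≈ fromℤ i + fromℤ j
  fromℤ-+ -[1+ m ] -[1+ n ] = begin
    - fromℕ (suc (suc (m ℕ.+ n)))      ≡⟨ ≡.cong (λ k → - fromℕ (suc k)) (+-suc m n) ⟨
    - fromℕ (suc m ℕ.+ suc n)          ≈⟨ -‿cong (×-homo-+ 1# (suc m) (suc n)) ⟩
    - (fromℕ (suc m) + fromℕ (suc n))  ≈⟨ ⁻¹-∙-comm _ _ ⟨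
    - fromℕ (suc m) + - fromℕ (suc n)  ∎
  fromℤ-+ -[1+ m ] (+ n)    = trans (fromℤ-⊖ n (suc m)) (+-comm _ _)
  fromℤ-+ (+ m)    -[1+ n ] = fromℤ-⊖ m (suc n)
  fromℤ-+ (+ m)    (+ n)    = ×-homo-+ 1# m n

  fromℤ-neg : ∀ i → fromℤ (ℤ.- i) ≈ - fromℤ i
  fromℤ-neg -[1+ n ]    = sym (-‿involutive _)
  fromℤ-neg (+ zero)    = sym -0#≈0#
  fromℤ-neg (+ (suc n)) = refl

  fromℤ-morphism : ℤ.+-*-rawRing ACR.-Raw-AlmostCommutative⟶ ACR.fromCommutativeRing CR
  fromℤ-morphism = record
    { ⟦_⟧    = fromℤ
    ; +-homo = fromℤ-+
    ; *-homo = fromℤ-*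
    ; -‿homo = fromℤ-neg
    ; 0-homo = refl
    ; 1-homo = +-identityʳ 1#
    }

  fromℤ-≟ : ∀ i j → Maybe (fromℤ i ≈ fromℤ j)
  fromℤ-≟ i j = Maybe.map (λ { ≡.refl → refl }) (dec⇒maybe (i ℤ.≟ j))

  open RingSolver ℤ.+-*-rawRing (ACR.fromCommutativeRing CR) fromℤ-morphism fromℤ-≟
    public using (Polynomial; solve; _:=_; _:+_; _:*_; _:-_; :-_; _:^_; con)

module OrderedFieldLemmas (R : CompleteOrderedField) where

  open import Data.Product using (Σ; ∃; proj₁; proj₂)
  open import Data.Sum using (inj₁; inj₂)
  open import Data.Empty using (⊥-elim)
  open import Level using (0ℓ)
  open import Relation.Binary.Bundles using (Poset)
  import Relation.Binary.Reasoning.PartialOrder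

  open CompleteOrderedField R
  open import Algebra.Properties.Ring ring using (-‿involutive; -0#≈0#)
  open import Algebra.Properties.CommutativeSemiring.Exp commutativeSemiring public using (_^_)
  open import Algebra.Properties.CommutativeSemiring.Exp commutativeSemiring using (^-distrib-*)
  open import Algebra.Properties.Semiring.Mult semiring using (×-homo-+)
  open import Relation.Binary.Reasoning.Setoid setoid
  open ℤ-RingSolver cring public

  infix 4 _≤_
  _≤_ : Carrier → Carrier → Set
  _≤_ = _≤ᴿ_

  ℕ→R≡fromℕ : ∀ n → ℕ→R R n ≡ fromℕ n
  ℕ→R≡fromℕ zero    = ≡.refl
  ℕ→R≡fromℕ (suc n) = ≡.cong (_+_ 1#) (ℕ→R≡fromℕ n)

  ℕ→R-+ : ∀ m n → ℕ→R R (m ℕ.+ n) ≈ ℕ→R R m + ℕ→R R n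
  ℕ→R-+ m n rewrite ℕ→R≡fromℕ (m ℕ.+ n) | ℕ→R≡fromℕ m | ℕ→R≡fromℕ n = ×-homo-+ 1# m n

  ≤-poset : Poset 0ℓ 0ℓ 0ℓ
  ≤-poset = record
    { isPartialOrder = record
      { isPreorder = record
        { isEquivalence = isEquivalence
        ; reflexive     = λ x≈y → ≤-resp refl x≈y ≤-refl
        ; trans         = ≤-trans
        }
      ; antisym = ≤-antisym
      }
    }

  module ≤-Reasoning = Relation.Binary.Reasoning.PartialOrder ≤-poset

  ≤-respˡ : ∀ {x x′ y} → x ≈ x′ → x ≤ y → x′ ≤ y
  ≤-respˡ x≈x′ = ≤-resp x≈x′ refl

  ≤-respʳ : ∀ {x y y′} → y ≈ y′ → x ≤ y → x ≤ y′
  ≤-respʳ y≈y′ = ≤-resp refl y≈y′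

  ≤⇒0≤- : ∀ {x y} → x ≤ y → 0# ≤ y - x
  ≤⇒0≤- {x} x≤y = ≤-respˡ (-‿inverseʳ x) (+-mono (- x) x≤y)

  0≤-⇒≤ : ∀ {x y} → 0# ≤ y - x → x ≤ y
  0≤-⇒≤ {x} {y} 0≤y-x =
    ≤-resp (+-identityˡ x) (solve 2 (λ x y → y :- x :+ x := y) refl x y) (+-mono x 0≤y-x)

  ≤0⇒0≤- : ∀ {x} → x ≤ 0# → 0# ≤ - x
  ≤0⇒0≤- x≤0 = ≤-respʳ (+-identityˡ _) (≤⇒0≤- x≤0)

  0≤x*x : ∀ x → 0# ≤ x * x
  0≤x*x x with ≤-total 0# x
  ... | inj₁ 0≤x = *-nonneg 0≤x 0≤x
  ... | inj₂ x≤0 = ≤-respʳ (solve 1 (λ x → (:- x) :* (:- x) := x :* x) refl x)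
                           (*-nonneg (≤0⇒0≤- x≤0) (≤0⇒0≤- x≤0))

  0≤1 : 0# ≤ 1#
  0≤1 = ≤-respʳ (*-identityˡ 1#) (0≤x*x 1#)

  *-monoˡ-≤ : ∀ {c x y} → 0# ≤ c → x ≤ y → c * x ≤ c * y
  *-monoˡ-≤ {c} {x} {y} 0≤c x≤y =
    0≤-⇒≤ (≤-respʳ (solve 3 (λ c x y → c :* (y :- x) := c :* y :- c :* x) refl c x y)
                   (*-nonneg 0≤c (≤⇒0≤- x≤y)))

  *-monoʳ-≤ : ∀ {c x y} → 0# ≤ c → x ≤ y → x * c ≤ y * c
  *-monoʳ-≤ 0≤c x≤y = ≤-resp (*-comm _ _) (*-comm _ _) (*-monoˡ-≤ 0≤c x≤y)

  x≤x+y : ∀ {x y} → 0# ≤ y → x ≤ x + y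
  x≤x+y {x} {y} 0≤y = ≤-resp (+-identityˡ x) (+-comm y x) (+-mono x 0≤y)

  y≤x+y : ∀ {x y} → 0# ≤ x → y ≤ x + y
  y≤x+y {x} {y} 0≤x = ≤-respʳ (+-comm y x) (x≤x+y 0≤x)

  +-nonneg : ∀ {x y} → 0# ≤ x → 0# ≤ y → 0# ≤ x + y
  +-nonneg 0≤x 0≤y = ≤-trans 0≤x (x≤x+y 0≤y)

  ^-nonneg : ∀ {x} k → 0# ≤ x → 0# ≤ x ^ k
  ^-nonneg zero    0≤x = 0≤1
  ^-nonneg (suc k) 0≤x = *-nonneg 0≤x (^-nonneg k 0≤x)

  1≤^ : ∀ {x} k → 1# ≤ x → 1# ≤ x ^ k
  1≤^ zero    1≤x = ≤-refl
  1≤^ {x} (suc k) 1≤x = ≤-trans (1≤^ k 1≤x)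
    (≤-respˡ (*-identityˡ _) (*-monoʳ-≤ (≤-trans 0≤1 (1≤^ k 1≤x)) 1≤x))

  -- The supremum s of the multiples of w satisfies s ≤ s - w.
  archimedean : ∀ {w c} → (∀ j → ℕ→R R j * w ≤ c) → w ≤ 0#
  archimedean {w} {c} bounded =
    ≤-resp (solve 2 (λ s w → s :+ w :- s := w) refl s w) (-‿inverseʳ s)
           (+-mono (- s) (≤-respʳ (solve 2 (λ s w → s :- w :+ w := s) refl s w) (+-mono w s≤s-w)))
    where
    Multiple : Carrier → Set
    Multiple t = Σ ℕ λ j → t ≈ ℕ→R R j * w
    bounded′ : ∀ t → Multiple t → t ≤ c
    bounded′ t (j , t≈jw) = ≤-respˡ (sym t≈jw) (bounded j)
    sup : ∃ λ s → (∀ t → Multiple t → t ≤ s) × (∀ b → (∀ t → Multiple t → t ≤ b) → s ≤ b)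
    sup = complete Multiple (ℕ→R R 0 * w , 0 , refl) (c , bounded′)
    s : Carrier
    s = proj₁ sup
    s-w-bound : ∀ t → Multiple t → t ≤ s - w
    s-w-bound t (j , t≈jw) = ≤-resp (solve 2 (λ w t → w :+ t :- w := t) refl w t) refl
      (+-mono (- w) (≤-respˡ (trans (distribʳ w 1# (ℕ→R R j)) (+-cong (*-identityˡ w) (sym t≈jw)))
                             (proj₁ (proj₂ sup) _ (suc j , refl))))
    s≤s-w : s ≤ s - w
    s≤s-w = proj₂ (proj₂ sup) (s - w) s-w-bound

  -- The axioms only give ¬ ¬ (w ≈ 0#); excluding infinitesimals gives w ≈ 0#.
  nonneg-nilpotent : ∀ {w} k → 0# ≤ w → w ^ k ≈ 0# → w ≈ 0#
  nonneg-nilpotent {w} k 0≤w wᵏ≈0 = ≤-antisym (archimedean multiples≤1) 0≤w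
    where
    multiples≤1 : ∀ j → ℕ→R R j * w ≤ 1#
    multiples≤1 j with ≤-total (ℕ→R R j * w) 1#
    ... | inj₁ jw≤1 = jw≤1
    ... | inj₂ 1≤jw = ⊥-elim (0≉1 (≤-antisym 0≤1 (≤-respʳ jwᵏ≈0 (1≤^ k 1≤jw))))
      where
      jwᵏ≈0 : (ℕ→R R j * w) ^ k ≈ 0#
      jwᵏ≈0 = trans (^-distrib-* (ℕ→R R j) w k) (trans (*-congˡ wᵏ≈0) (zeroʳ _))

  square≈0 : ∀ {w} → w * w ≈ 0# → w ≈ 0#
  square≈0 {w} w²≈0 with ≤-total 0# w
  ... | inj₁ 0≤w = nonneg-nilpotent 2 0≤w (trans (*-congˡ (*-identityʳ w)) w²≈0)
  ... | inj₂ w≤0 = begin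
    w       ≈⟨ -‿involutive w ⟨
    - - w   ≈⟨ -‿cong (nonneg-nilpotent 2 (≤0⇒0≤- w≤0) (-w²≈0)) ⟩
    - 0#    ≈⟨ -0#≈0# ⟩
    0#      ∎
    where
    -w²≈0 : (- w) ^ 2 ≈ 0#
    -w²≈0 = trans (solve 1 (λ w → (:- w) :^ 2 := w :* w) refl w) w²≈0

module RealRoots (R : CompleteOrderedField) where

  open import Data.Integer using (+_)
  open import Data.List using ([]; _∷_)
  open import Data.Product using (∃; proj₁; proj₂)
  open import Function using (_∘_)

  open CompleteOrderedField R
  open OrderedFieldLemmas R

  Re Im : ℂ R → Carrier
  Re = proj₁
  Im = proj₂

  infix 4 _≈ᶜ_
  _≈ᶜ_ : ℂ R → ℂ R → Set
  w ≈ᶜ w′ = (Re w ≈ Re w′) × (Im w ≈ Im w′)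

  infixl 6 _+ᶜ_
  _+ᶜ_ : ℂ R → ℂ R → ℂ R
  _+ᶜ_ = _+ℂ_ R

  infixl 7 _*ᶜ_
  _*ᶜ_ : ℂ R → ℂ R → ℂ R
  _*ᶜ_ = _*ℂ_ R

  ≈ᶜ-trans : ∀ {w w′ w″} → w ≈ᶜ w′ → w′ ≈ᶜ w″ → w ≈ᶜ w″
  ≈ᶜ-trans (p , q) (p′ , q′) = trans p p′ , trans q q′

  +ᶜ-cong : ∀ {w w′ y y′} → w ≈ᶜ w′ → y ≈ᶜ y′ → w +ᶜ y ≈ᶜ w′ +ᶜ y′
  +ᶜ-cong (p , q) (p′ , q′) = +-cong p p′ , +-cong q q′

  *ᶜ-congˡ : ∀ z {w w′} → w ≈ᶜ w′ → z *ᶜ w ≈ᶜ z *ᶜ w′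
  *ᶜ-congˡ z (p , q) = +-cong (*-congˡ p) (-‿cong (*-congˡ q)) , +-cong (*-congˡ q) (*-congˡ p)

  normSq : ℂ R → Carrier
  normSq (a , b) = a * a + b * b

  -- Im (w · conj w′)
  wronskian : ℂ R → ℂ R → Carrier
  wronskian (a , b) (a′ , b′) = b * a′ - a * b′

  wronskian-cong : ∀ {w w′ y y′} → w ≈ᶜ w′ → y ≈ᶜ y′ → wronskian w y ≈ wronskian w′ y′
  wronskian-cong (p , q) (p′ , q′) = +-cong (*-cong q p′) (-‿cong (*-cong p q′))

  -- The complex operations mirrored on solver syntax, so that the meaning of
  -- a mirrored expression is definitionally the original one.
  module Mirror {k : ℕ} where
    Pair : Set
    Pair = Polynomial k × Polynomial k

    infixl 6 _+ˢ_
    infixl 7 _*ˢ_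

    _+ˢ_ : Pair → Pair → Pair
    (a , b) +ˢ (c , d) = (a :+ c) , (b :+ d)

    _*ˢ_ : Pair → Pair → Pair
    (a , b) *ˢ (c , d) = (a :* c :- b :* d) , (a :* d :+ b :* c)

    normSqˢ : Pair → Polynomial k
    normSqˢ (a , b) = a :* a :+ b :* b

    wronskianˢ : Pair → Pair → Polynomial k
    wronskianˢ (a , b) (a′ , b′) = b :* a′ :- a :* b′

  open Mirror

  -- Take imaginary parts in
  -- f₃ conj f₂ = |f₂|² + z f₁ conj f₂ = |f₂|² + z |f₁|² + |z|² f₁ conj f₀.
  wronskian-step : ∀ z f₀ f₁ → let f₂ = f₁ +ᶜ z *ᶜ f₀ in
    wronskian (f₂ +ᶜ z *ᶜ f₁) f₂ ≈ Im z * normSq f₁ + normSq z * wronskian f₁ f₀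
  wronskian-step (u , v) (a₀ , b₀) (a₁ , b₁) = solve 6 (λ u v a₀ b₀ a₁ b₁ →
      let z = u , v ; f₀ = a₀ , b₀ ; f₁ = a₁ , b₁ ; f₂ = f₁ +ˢ z *ˢ f₀ in
      wronskianˢ (f₂ +ˢ z *ˢ f₁) f₂ := v :* normSqˢ f₁ :+ normSqˢ z :* wronskianˢ f₁ f₀)
    refl u v a₀ b₀ a₁ b₁

  module Recurrence (z : ℂ R) (f : ℕ → ℂ R)
                    (rec : ∀ m → f (suc (suc m)) ≈ᶜ f (suc m) +ᶜ z *ᶜ f m) where

    W : ℕ → Carrier
    W m = wronskian (f (suc m)) (f m)

    W-step : ∀ m → W (suc (suc m)) ≈ Im z * normSq (f (suc m)) + normSq z * W m
    W-step m =
      trans (wronskian-cong (≈ᶜ-trans (rec (suc m)) (+ᶜ-cong (rec m) (*ᶜ-congˡ z (refl , refl)))) (rec m))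
            (wronskian-step z (f m) (f (suc m)))

    v : Carrier
    v = Im z

    lower-bound : v * v ≤ v * W 0 → v * v ≤ v * W 1 → ∀ m → ∃ λ e → (v * v) ^ suc e ≤ v * W m
    lower-bound b₀ b₁ zero          = 0 , ≤-respˡ (sym (*-identityʳ _)) b₀
    lower-bound b₀ b₁ (suc zero)    = 0 , ≤-respˡ (sym (*-identityʳ _)) b₁
    lower-bound b₀ b₁ (suc (suc m)) with lower-bound b₀ b₁ m
    ... | e , tᵉ⁺¹≤vW = suc e , (begin
      (v * v) * (v * v) ^ suc e              ≤⟨ *-monoˡ-≤ (0≤x*x v) tᵉ⁺¹≤vW ⟩
      (v * v) * (v * W m)                    ≤⟨ *-monoʳ-≤ 0≤vW (y≤x+y (0≤x*x (Re z))) ⟩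
      normSq z * (v * W m)                   ≤⟨ y≤x+y (*-nonneg (0≤x*x v) (+-nonneg (0≤x*x _) (0≤x*x _))) ⟩
      (v * v) * normSq (f (suc m)) + normSq z * (v * W m)
        ≈⟨ solve 4 (λ v n q w → (v :* v) :* n :+ q :* (v :* w) := v :* (v :* n :+ q :* w)) refl v _ _ (W m) ⟩
      v * (v * normSq (f (suc m)) + normSq z * W m) ≈⟨ *-congˡ (W-step m) ⟨
      v * W (suc (suc m))                    ∎)
      where
      open ≤-Reasoning
      0≤vW : 0# ≤ v * W m
      0≤vW = ≤-trans (^-nonneg (suc e) (0≤x*x v)) tᵉ⁺¹≤vW

    root⇒real : v * v ≤ v * W 0 → v * v ≤ v * W 1 → ∀ m → f (suc m) ≈ᶜ (0# , 0#) → v ≈ 0#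
    root⇒real b₀ b₁ m root = square≈0 (nonneg-nilpotent (suc e) (0≤x*x v) tᵉ⁺¹≈0)
      where
      e : ℕ
      e = proj₁ (lower-bound b₀ b₁ m)
      W≈0 : W m ≈ 0#
      W≈0 = trans (wronskian-cong root (refl , refl))
                  (solve 2 (λ a b → con (+ 0) :* a :- con (+ 0) :* b := con (+ 0)) refl (Re (f m)) (Im (f m)))
      tᵉ⁺¹≈0 : (v * v) ^ suc e ≈ 0#
      tᵉ⁺¹≈0 = ≤-antisym (≤-respʳ (trans (*-congˡ W≈0) (zeroʳ v)) (proj₂ (lower-bound b₀ b₁ m)))
                         (^-nonneg (suc e) (0≤x*x v))

  module AppleRoots (u v : Carrier) where
    z : ℂ R
    z = u , v

    evalSeq : (ℕ → ℕ) → ℕ → ℂ R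
    evalSeq c L = evalℂ R (applyUpTo c L) z

    horner-+ : ∀ x y w w′ →
      (x + y , 0#) +ᶜ z *ᶜ (w +ᶜ w′) ≈ᶜ ((x , 0#) +ᶜ z *ᶜ w) +ᶜ ((y , 0#) +ᶜ z *ᶜ w′)
    horner-+ x y (a , b) (a′ , b′) =
        solve 8 (λ x y u v a b a′ b′ → proj₁ (lhs x y u v a b a′ b′) := proj₁ (rhs x y u v a b a′ b′))
          refl x y u v a b a′ b′
      , solve 8 (λ x y u v a b a′ b′ → proj₂ (lhs x y u v a b a′ b′) := proj₂ (rhs x y u v a b a′ b′))
          refl x y u v a b a′ b′
      where
      lhs rhs : ∀ {k} (x y u v a b a′ b′ : Polynomial k) → Pair
      lhs x y u v a b a′ b′ = (x :+ y , con (+ 0)) +ˢ (u , v) *ˢ ((a , b) +ˢ (a′ , b′))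
      rhs x y u v a b a′ b′ =
        ((x , con (+ 0)) +ˢ (u , v) *ˢ (a , b)) +ˢ ((y , con (+ 0)) +ˢ (u , v) *ˢ (a′ , b′))

    evalSeq-+ : ∀ L c d → evalSeq (λ k → c k ℕ.+ d k) L ≈ᶜ evalSeq c L +ᶜ evalSeq d L
    evalSeq-+ zero    c d = sym (+-identityˡ 0#) , sym (+-identityˡ 0#)
    evalSeq-+ (suc L) c d =
      ≈ᶜ-trans (+ᶜ-cong (ℕ→R-+ (c 0) (d 0) , refl) (*ᶜ-congˡ z (evalSeq-+ L (c ∘ suc) (d ∘ suc))))
               (horner-+ (ℕ→R R (c 0)) (ℕ→R R (d 0)) (evalSeq (c ∘ suc) L) (evalSeq (d ∘ suc) L))

    evalSeq-shift : ∀ L c → evalSeq (shift c) (suc L) ≈ᶜ z *ᶜ evalSeq c L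
    evalSeq-shift L c = +-identityˡ _ , +-identityˡ _

    evalSeq-pad : ∀ L c → c L ≡ 0 → evalSeq c (suc L) ≈ᶜ evalSeq c L
    evalSeq-pad zero    c cL≡0 rewrite cL≡0 =
        solve 2 (λ u v → con (+ 0) :+ (u :* con (+ 0) :- v :* con (+ 0)) := con (+ 0)) refl u v
      , solve 2 (λ u v → con (+ 0) :+ (u :* con (+ 0) :+ v :* con (+ 0)) := con (+ 0)) refl u v
    evalSeq-pad (suc L) c cL≡0 = +ᶜ-cong (refl , refl) (*ᶜ-congˡ z (evalSeq-pad L (c ∘ suc) cL≡0))

    f : ℕ → ℂ R
    f m = evalSeq (apple m) (suc (suc m))

    f-rec : ∀ m → f (suc (suc m)) ≈ᶜ f (suc m) +ᶜ z *ᶜ f m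
    f-rec m = ≈ᶜ-trans (evalSeq-+ (4 ℕ.+ m) (apple (suc m)) (shift (apple m)))
      (+ᶜ-cong (evalSeq-pad (3 ℕ.+ m) (apple (suc m)) (apple-vanishes (suc m) (3 ℕ.+ m) ℕ.≤-refl))
               (≈ᶜ-trans (evalSeq-shift (3 ℕ.+ m) (apple m))
                         (*ᶜ-congˡ z (evalSeq-pad (2 ℕ.+ m) (apple m) (apple-vanishes m (2 ℕ.+ m) ℕ.≤-refl)))))

    evalℂ-linear : ∀ c d → evalℂ R (c ∷ d ∷ []) z ≈ᶜ (ℕ→R R c + ℕ→R R d * u , ℕ→R R d * v)
    evalℂ-linear c d =
        solve 4 (λ x y u v → proj₁ (horner x y u v) := x :+ y :* u) refl (ℕ→R R c) (ℕ→R R d) u v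
      , solve 4 (λ x y u v → proj₂ (horner x y u v) := y :* v) refl (ℕ→R R c) (ℕ→R R d) u v
      where
      horner : ∀ {k} (x y u v : Polynomial k) → Pair
      horner x y u v = (x , con (+ 0)) +ˢ (u , v) *ˢ ((y , con (+ 0)) +ˢ (u , v) *ˢ (con (+ 0) , con (+ 0)))

    open Recurrence z f f-rec hiding (v)

    f₀≈ : f 0 ≈ᶜ (ℕ→R R 2 + ℕ→R R 1 * u , ℕ→R R 1 * v)
    f₀≈ = evalℂ-linear 2 1

    f₁≈ : f 1 ≈ᶜ (ℕ→R R 1 + ℕ→R R 1 * u , ℕ→R R 1 * v)
    f₁≈ = ≈ᶜ-trans (evalSeq-pad 2 (apple 1) ≡.refl) (evalℂ-linear 1 1)

    W₀-bound : v * v ≤ v * W 0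
    W₀-bound = ≤-respʳ (*-congˡ (sym W₀≈v)) ≤-refl
      where
      W₀≈v : W 0 ≈ v
      W₀≈v = trans (wronskian-cong f₁≈ f₀≈)
        (solve 2 (λ u v → wronskianˢ (con (+ 1) :+ con (+ 1) :* u , con (+ 1) :* v)
                                     (con (+ 2) :+ con (+ 1) :* u , con (+ 1) :* v) := v) refl u v)

    W₁-bound : v * v ≤ v * W 1
    W₁-bound = ≤-respʳ (sym vW₁≈) (y≤x+y (*-nonneg (0≤x*x v) (+-nonneg (0≤x*x _) (0≤x*x _))))
      where
      p₁ : ℂ R
      p₁ = ℕ→R R 1 + ℕ→R R 1 * u , ℕ→R R 1 * v
      vW₁≈ : v * W 1 ≈ (v * v) * normSq p₁ + v * v
      vW₁≈ =
        trans (*-congˡ (wronskian-cong (≈ᶜ-trans (f-rec 0) (+ᶜ-cong f₁≈ (*ᶜ-congˡ z f₀≈))) f₁≈))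
        (solve 2 (λ u v → let p₀ = con (+ 2) :+ con (+ 1) :* u , con (+ 1) :* v
                              p₁ = con (+ 1) :+ con (+ 1) :* u , con (+ 1) :* v in
                   v :* wronskianˢ (p₁ +ˢ (u , v) *ˢ p₀) p₁ := (v :* v) :* normSqˢ p₁ :+ v :* v) refl u v)

    apple-roots-real : ∀ m → IsRootℂ R (applyUpTo (apple (suc m)) (3 ℕ.+ m)) z → v ≈ 0#
    apple-roots-real = root⇒real W₀-bound W₁-bound

open import Data.Nat using (_≤_; s≤s)

-- The bound 4 ≤ n is only used to write n = m + 2.
mainTheorem10 : (n : ℕ) → 4 ≤ n →
    ((R : CompleteOrderedField) → RealRooted R (indPoly n))
    × LogConcave (indCoeff n) × Unimodal (indCoeff n)
mainTheorem10 (suc zero)    (s≤s ())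
mainTheorem10 (suc (suc m)) _ = realRooted , PF₂⇒logConcave {indCoeff (suc (suc m))} pf₂ , unimodal
  where
  coefficients : ∀ k → apple (suc m) k ≡ indCoeff (suc (suc m)) k
  coefficients k = ≡.sym (indCoeff≡apple m k)
  pf₂ : PF₂ (indCoeff (suc (suc m)))
  pf₂ = PF₂-cong coefficients (apple-PF₂ (suc m))
  unimodal : Unimodal (indCoeff (suc (suc m)))
  unimodal = PF₂⇒unimodal pf₂ (≡.subst (1 ≤_) (coefficients 0) (apple-constant-positive (suc m)))
    (3 ℕ.+ m) (≡.trans (≡.sym (coefficients (3 ℕ.+ m))) (apple-vanishes (suc m) (3 ℕ.+ m) ℕ.≤-refl))
  indPoly≡ : indPoly (suc (suc m)) ≡ applyUpTo (apple (suc m)) (3 ℕ.+ m)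
  indPoly≡ = ≡.trans (List.map-cong (≡.sym ∘ coefficients) (upTo (3 ℕ.+ m)))
                     (List.map-applyUpTo id (apple (suc m)) (3 ℕ.+ m))
  realRooted : (R : CompleteOrderedField) → RealRooted R (indPoly (suc (suc m)))
  realRooted R (u , v) root =
    RealRoots.AppleRoots.apple-roots-real R u v m (≡.subst (λ p → IsRootℂ R p (u , v)) indPoly≡ root)
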